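{- For every integer $k\ge 1$, the minimum $n$ such that there exists a separating family of $k$ proper bipartitions for an $n$-element set is $\lceil\log_2(k+1)\rceil+1$.
   Context: A bipartition of a set $S$ is a partition of $S$ into at most two nonempty components; it is proper if it has exactly two components. A bipartition cuts two elements if they lie in different components. A family of (distinct) bipartitions of $S$ is a separating family for $S$ if every two distinct elements of $S$ are cut by some bipartition in the family. -}

module Defs where

open import Data.Nat using (ℕ)
open import Data.Fin using (Fin)
open import Data.Bool using (Bool; true; false; not)
open import Data.Product using (Σ; ∃; _×_)
open import Data.Sum using (_⊎_)
open import Relation.Nullary using (¬_)
open import Relation.Binary.PropositionalEquality using (_≡_; _≢_)

-- A bipartition of the n-element set Fin n is represented by a labelling
-- Fin n → Bool; its components are the nonempty fibres (at most two).
Bipartition : ℕ → Set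
Bipartition n = Fin n → Bool

Proper : ∀ {n} → Bipartition n → Set
Proper {n} f = Σ (Fin n) λ x → Σ (Fin n) λ y → (f x ≡ true) × (f y ≡ false)

-- Two labellings describe the same partition iff equal or complementary.
SameBipartition : ∀ {n} → Bipartition n → Bipartition n → Set
SameBipartition {n} f g = (∀ x → f x ≡ g x) ⊎ (∀ x → f x ≡ not (g x))

Cuts : ∀ {n} → Bipartition n → Fin n → Fin n → Set
Cuts f x y = f x ≢ f y

Family : ℕ → ℕ → Set
Family k n = Fin k → Bipartition n

Distinct : ∀ {k n} → Family k n → Set
Distinct {k} F = ∀ (i j : Fin k) → i ≢ j → ¬ SameBipartition (F i) (F j)

AllProper : ∀ {k n} → Family k n → Set
AllProper {k} F = ∀ (i : Fin k) → Proper (F i)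

Separating : ∀ {k n} → Family k n → Set
Separating {k} {n} F = ∀ (x y : Fin n) → x ≢ y → ∃ λ (i : Fin k) → Cuts (F i) x y

HasSeparatingFamily : ℕ → ℕ → Set
HasSeparatingFamily k n =
  Σ (Family k n) λ F → Distinct F × AllProper F × Separating F

-- Normalise every bipartition of {0,…,m} so that 0 gets the label false; the labels of
-- 1,…,m then form a vector in {0,1}^m that determines the bipartition, is nonzero when the
-- bipartition is proper, and differs between distinct bipartitions.  So k ≤ 2^m − 1, i.e.
-- n = m + 1 ≥ ⌈log₂(k+1)⌉ + 1.  Conversely, for L = ⌈log₂(k+1)⌉ label 0 by false and 1,…,L by
-- the L binary digits of 1,…,k.  As 2^(L−1) ≤ k, every unit vector occurs among these codes,
-- and the member coded by the unit vector at x cuts x from every other element.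

module Submission where

open import Defs
open import Data.Nat using (ℕ; zero; suc; _+_; _*_; _^_; _≤_; _<_; z≤n; s≤s; ⌊_/2⌋; ⌈_/2⌉)
open import Data.Nat.Logarithm using (⌈log₂_⌉; ⌈log₂⌉-mono-≤; ⌈log₂⌈n/2⌉⌉≡⌈log₂n⌉∸1; ⌈log₂2^n⌉≡n)
open import Data.Nat.Properties
  using (module ≤-Reasoning; ≤-refl; ≤-trans; ≤-pred; <⇒≱; ≰⇒>; suc-injective; 0≢1+n; +-comm;
         +-identityʳ; *-identityʳ; *-zeroʳ; +-monoˡ-≤; *-monoʳ-≤; ∸-monoˡ-≤; m^n>0; ⌊n/2⌋≤⌈n/2⌉; ⌊n/2⌋+⌈n/2⌉≡n)
open import Data.Fin using (Fin; toℕ; fromℕ; fromℕ<; inject₁; inject≤; opposite; combine; remQuot)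
  renaming (zero to fzero; suc to fsuc)
open import Data.Fin.Properties
  using (2↔Bool; _≟_; remQuot-combine; combine-remQuot; toℕ-combine; toℕ-inject≤; toℕ-fromℕ<;
         toℕ-injective; toℕ-fromℕ; toℕ-inject₁; toℕ<n; injective⇒≤; ¬∀⟶∃¬)
open import Data.Bool using (Bool; true; false; not; _xor_)
import Data.Bool.Properties as Bool
open import Data.Product using (Σ; _×_; _,_; proj₁; proj₂)
open import Data.Sum using (inj₁; inj₂)
open import Data.Empty using (⊥-elim)
open import Function using (_∘_; Inverse)
open import Relation.Nullary using (¬_; yes; no; does)
open import Relation.Nullary.Decidable using (dec-true; dec-false)
open import Relation.Binary.PropositionalEquality

open Inverse 2↔Bool using ()
  renaming (to to toBool; from to fromBool;
            strictlyInverseˡ to toBool-fromBool; strictlyInverseʳ to fromBool-toBool)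

-- Big-endian: combine makes the first coordinate the most significant digit, which is why
-- opposite appears in toℕ-encode-unit.
encode : ∀ {m} → (Fin m → Bool) → Fin (2 ^ m)
encode {zero}  v = fzero
encode {suc m} v = combine (fromBool (v fzero)) (encode (v ∘ fsuc))

decode : ∀ m → Fin (2 ^ m) → Fin m → Bool
decode (suc m) c fzero    = toBool (proj₁ (remQuot {2} (2 ^ m) c))
decode (suc m) c (fsuc x) = decode m (proj₂ (remQuot {2} (2 ^ m) c)) x

decode-encode : ∀ {m} (v : Fin m → Bool) → decode m (encode v) ≗ v
decode-encode {suc m} v fzero =
  trans (cong (toBool ∘ proj₁) (remQuot-combine (fromBool (v fzero)) (encode (v ∘ fsuc))))
        (toBool-fromBool (v fzero))
decode-encode {suc m} v (fsuc x) =
  trans (cong (λ c → decode m (proj₂ c) x) (remQuot-combine (fromBool (v fzero)) (encode (v ∘ fsuc))))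
        (decode-encode (v ∘ fsuc) x)

encode-cong : ∀ {m} {v w : Fin m → Bool} → v ≗ w → encode v ≡ encode w
encode-cong {zero}  v≗w = refl
encode-cong {suc m} v≗w = cong₂ combine (cong fromBool (v≗w fzero)) (encode-cong (v≗w ∘ fsuc))

encode-decode : ∀ m (c : Fin (2 ^ m)) → encode (decode m c) ≡ c
encode-decode zero    fzero = refl
encode-decode (suc m) c = begin
  combine (fromBool (toBool r)) (encode (decode m q)) ≡⟨ cong₂ combine (fromBool-toBool r) (encode-decode m q) ⟩
  combine r q                                         ≡⟨ combine-remQuot {2} (2 ^ m) c ⟩
  c                                                   ∎
  where
  open ≡-Reasoning
  r = proj₁ (remQuot {2} (2 ^ m) c)
  q = proj₂ (remQuot {2} (2 ^ m) c)

decode-injective : ∀ m {c d : Fin (2 ^ m)} → decode m c ≗ decode m d → c ≡ d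
decode-injective m {c} {d} eq =
  trans (sym (encode-decode m c)) (trans (encode-cong eq) (encode-decode m d))

pointwise-injective⇒≤2^ : ∀ {a m} (h : Fin a → Fin m → Bool) →
  (∀ {i j} → h i ≗ h j → i ≡ j) → a ≤ 2 ^ m
pointwise-injective⇒≤2^ {m = m} h inj = injective⇒≤ {f = encode ∘ h} λ {i} {j} eq →
  inj λ x → trans (sym (decode-encode (h i) x)) (trans (cong (λ c → decode m c x) eq) (decode-encode (h j) x))

toℕ-encode-false : ∀ {m} → toℕ (encode {m} (λ _ → false)) ≡ 0
toℕ-encode-false {zero}  = refl
toℕ-encode-false {suc m} = begin
  toℕ (combine {2} fzero (encode {m} (λ _ → false))) ≡⟨ toℕ-combine {2} fzero (encode {m} (λ _ → false)) ⟩
  2 ^ m * 0 + toℕ (encode {m} (λ _ → false))          ≡⟨ cong₂ _+_ (*-zeroʳ (2 ^ m)) (toℕ-encode-false {m}) ⟩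
  0                                                   ∎
  where open ≡-Reasoning

decode-false⇒toℕ≡0 : ∀ m {c : Fin (2 ^ m)} → decode m c ≗ (λ _ → false) → toℕ c ≡ 0
decode-false⇒toℕ≡0 m {c} eq =
  trans (cong toℕ (trans (sym (encode-decode m c)) (encode-cong eq))) (toℕ-encode-false {m})

unit : ∀ {m} → Fin m → Fin m → Bool
unit x y = does (x ≟ y)

unit-self : ∀ {m} (x : Fin m) → unit x x ≡ true
unit-self x = dec-true (x ≟ x) refl

unit-other : ∀ {m} (x y : Fin m) → x ≢ y → unit x y ≡ false
unit-other x y = dec-false (x ≟ y)

toℕ-encode-unit : ∀ {m} (x : Fin m) → toℕ (encode (unit x)) ≡ 2 ^ toℕ (opposite x)
toℕ-encode-unit {suc m} fzero = begin
  toℕ (combine {2} (fsuc fzero) (encode {m} (λ _ → false)))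
    ≡⟨ toℕ-combine {2} (fsuc fzero) (encode {m} (λ _ → false)) ⟩
  2 ^ m * 1 + toℕ (encode {m} (λ _ → false)) ≡⟨ cong₂ _+_ (*-identityʳ (2 ^ m)) (toℕ-encode-false {m}) ⟩
  2 ^ m + 0                                  ≡⟨ +-identityʳ (2 ^ m) ⟩
  2 ^ m                                      ≡⟨ cong (2 ^_) (toℕ-fromℕ m) ⟨
  2 ^ toℕ (fromℕ m)                          ∎
  where open ≡-Reasoning
toℕ-encode-unit {suc m} (fsuc x) = begin
  toℕ (combine {2} fzero (encode (unit x))) ≡⟨ toℕ-combine {2} fzero (encode (unit x)) ⟩
  2 ^ m * 0 + toℕ (encode (unit x))         ≡⟨ cong₂ _+_ (*-zeroʳ (2 ^ m)) (toℕ-encode-unit x) ⟩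
  2 ^ toℕ (opposite x)                      ≡⟨ cong (2 ^_) (toℕ-inject₁ (opposite x)) ⟨
  2 ^ toℕ (inject₁ (opposite x))            ∎
  where open ≡-Reasoning

n≤2*⌈n/2⌉ : ∀ n → n ≤ 2 * ⌈ n /2⌉
n≤2*⌈n/2⌉ n = begin
  n                       ≡⟨ ⌊n/2⌋+⌈n/2⌉≡n n ⟨
  ⌊ n /2⌋ + ⌈ n /2⌉       ≤⟨ +-monoˡ-≤ ⌈ n /2⌉ (⌊n/2⌋≤⌈n/2⌉ n) ⟩
  ⌈ n /2⌉ + ⌈ n /2⌉       ≡⟨ cong (⌈ n /2⌉ +_) (+-identityʳ ⌈ n /2⌉) ⟨
  2 * ⌈ n /2⌉             ∎
  where open ≤-Reasoning

⌈log₂n⌉≤m⇒n≤2^m : ∀ m {n} → ⌈log₂ n ⌉ ≤ m → n ≤ 2 ^ m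
⌈log₂n⌉≤m⇒n≤2^m zero {zero}          _ = z≤n
⌈log₂n⌉≤m⇒n≤2^m zero {suc zero}      _ = ≤-refl
⌈log₂n⌉≤m⇒n≤2^m zero {suc (suc n)} ⌈log₂n⌉≤0
  with () ← ≤-trans (⌈log₂⌉-mono-≤ {2} {suc (suc n)} (s≤s (s≤s z≤n))) ⌈log₂n⌉≤0
⌈log₂n⌉≤m⇒n≤2^m (suc m) {n} ⌈log₂n⌉≤1+m = begin
  n            ≤⟨ n≤2*⌈n/2⌉ n ⟩
  2 * ⌈ n /2⌉  ≤⟨ *-monoʳ-≤ 2 (⌈log₂n⌉≤m⇒n≤2^m m {⌈ n /2⌉} ⌈log₂⌈n/2⌉⌉≤m) ⟩
  2 * 2 ^ m    ∎
  where
  open ≤-Reasoning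
  ⌈log₂⌈n/2⌉⌉≤m : ⌈log₂ ⌈ n /2⌉ ⌉ ≤ m
  ⌈log₂⌈n/2⌉⌉≤m = subst (_≤ m) (sym (⌈log₂⌈n/2⌉⌉≡⌈log₂n⌉∸1 n)) (∸-monoˡ-≤ 1 ⌈log₂n⌉≤1+m)

n≤2^m⇒⌈log₂n⌉≤m : ∀ {m n} → n ≤ 2 ^ m → ⌈log₂ n ⌉ ≤ m
n≤2^m⇒⌈log₂n⌉≤m {m} {n} n≤2^m = subst (⌈log₂ n ⌉ ≤_) (⌈log₂2^n⌉≡n m) (⌈log₂⌉-mono-≤ n≤2^m)

m<⌈log₂n⌉⇒2^m<n : ∀ {m n} → m < ⌈log₂ n ⌉ → 2 ^ m < n
m<⌈log₂n⌉⇒2^m<n m<⌈log₂n⌉ = ≰⇒> (<⇒≱ m<⌈log₂n⌉ ∘ n≤2^m⇒⌈log₂n⌉≤m)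

normalise : ∀ {m} → Bipartition (suc m) → Fin m → Bool
normalise f x = f fzero xor f (fsuc x)

xor-normalise : ∀ {m} (f : Bipartition (suc m)) x → f fzero xor normalise f x ≡ f (fsuc x)
xor-normalise f x = begin
  f fzero xor (f fzero xor f (fsuc x)) ≡⟨ Bool.xor-assoc (f fzero) (f fzero) (f (fsuc x)) ⟨
  (f fzero xor f fzero) xor f (fsuc x) ≡⟨ cong (_xor f (fsuc x)) (Bool.xor-same (f fzero)) ⟩
  f (fsuc x)                           ∎
  where open ≡-Reasoning

normalise-≗⇒SameBipartition : ∀ {m} {f g : Bipartition (suc m)} →
  normalise f ≗ normalise g → SameBipartition f g
normalise-≗⇒SameBipartition {f = f} {g} eq with f fzero Bool.≟ g fzero
... | yes f₀≡g₀ = inj₁ λ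
  { fzero    → f₀≡g₀
  ; (fsuc x) → begin
      f (fsuc x)                 ≡⟨ xor-normalise f x ⟨
      f fzero xor normalise f x  ≡⟨ cong₂ _xor_ f₀≡g₀ (eq x) ⟩
      g fzero xor normalise g x  ≡⟨ xor-normalise g x ⟩
      g (fsuc x)                 ∎ }
  where open ≡-Reasoning
... | no f₀≢g₀ = inj₂ λ
  { fzero    → Bool.¬-not f₀≢g₀
  ; (fsuc x) → begin
      f (fsuc x)                      ≡⟨ xor-normalise f x ⟨
      f fzero xor normalise f x       ≡⟨ cong₂ _xor_ (Bool.¬-not f₀≢g₀) (eq x) ⟩
      not (g fzero) xor normalise g x ≡⟨ Bool.not-distribˡ-xor (g fzero) (normalise g x) ⟨
      not (g fzero xor normalise g x) ≡⟨ cong not (xor-normalise g x) ⟩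
      not (g (fsuc x))                ∎ }
  where open ≡-Reasoning

Proper⇒normalise≢false : ∀ {m} {f : Bipartition (suc m)} → Proper f → ¬ (normalise f ≗ λ _ → false)
Proper⇒normalise≢false {f = f} (x , y , fx≡true , fy≡false) normalise≡false =
  Bool.not-¬ fx≡true (trans (constant x) (trans (sym (constant y)) fy≡false))
  where
  constant : ∀ z → f z ≡ f fzero
  constant fzero    = refl
  constant (fsuc z) = begin
    f (fsuc z)                ≡⟨ xor-normalise f z ⟨
    f fzero xor normalise f z ≡⟨ cong (f fzero xor_) (normalise≡false z) ⟩
    f fzero xor false         ≡⟨ Bool.xor-comm (f fzero) false ⟩
    f fzero                   ∎
    where open ≡-Reasoning

distinct-proper⇒suc≤2^ : ∀ {k m} (F : Family k (suc m)) → Distinct F → AllProper F → suc k ≤ 2 ^ m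
distinct-proper⇒suc≤2^ {k} {m} F distinct proper = pointwise-injective⇒≤2^ codes codes-injective
  where
  codes : Fin (suc k) → Fin m → Bool
  codes fzero    = λ _ → false
  codes (fsuc i) = normalise (F i)

  codes-injective : ∀ {i j} → codes i ≗ codes j → i ≡ j
  codes-injective {fzero}  {fzero}  _  = refl
  codes-injective {fzero}  {fsuc j} eq = ⊥-elim (Proper⇒normalise≢false (proper j) (sym ∘ eq))
  codes-injective {fsuc i} {fzero}  eq = ⊥-elim (Proper⇒normalise≢false (proper i) eq)
  codes-injective {fsuc i} {fsuc j} eq with i ≟ j
  ... | yes i≡j = cong fsuc i≡j
  ... | no i≢j  = ⊥-elim (distinct i j i≢j (normalise-≗⇒SameBipartition eq))

lower-bound : ∀ {k n} → 1 ≤ k → HasSeparatingFamily k n → suc ⌈log₂ suc k ⌉ ≤ n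
lower-bound {suc k} {zero} _ (_ , _ , proper , _) with () ← proj₁ (proper fzero)
lower-bound {n = suc m} _ (F , distinct , proper , _) =
  s≤s (n≤2^m⇒⌈log₂n⌉≤m (distinct-proper⇒suc≤2^ F distinct proper))

module _ {k L : ℕ} (fits : suc k ≤ 2 ^ L) (small : ∀ {m} → m < L → 2 ^ m < suc k) where

  code : Fin k → Fin (2 ^ L)
  code i = inject≤ (fsuc i) fits

  toℕ-code : ∀ i → toℕ (code i) ≡ suc (toℕ i)
  toℕ-code i = toℕ-inject≤ (fsuc i) fits

  code-onto : ∀ (c : Fin (2 ^ L)) → 0 < toℕ c → toℕ c ≤ k → Σ (Fin k) λ i → code i ≡ c
  code-onto c 0<c c≤k with toℕ c in eq
  ... | suc j = fromℕ< c≤k , toℕ-injective (begin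
    toℕ (code (fromℕ< c≤k)) ≡⟨ toℕ-code (fromℕ< c≤k) ⟩
    suc (toℕ (fromℕ< c≤k))  ≡⟨ cong suc (toℕ-fromℕ< c≤k) ⟩
    suc j                   ≡⟨ eq ⟨
    toℕ c                   ∎)
    where open ≡-Reasoning

  unit-index : ∀ x → Σ (Fin k) λ i → code i ≡ encode (unit x)
  unit-index x = code-onto (encode (unit x))
    (subst (0 <_) (sym (toℕ-encode-unit x)) (m^n>0 2 (toℕ (opposite x))))
    (subst (_≤ k) (sym (toℕ-encode-unit x)) (≤-pred (small (toℕ<n (opposite x)))))

  family : Family k (suc L)
  family i fzero    = false
  family i (fsuc x) = decode L (code i) x

  family-unit : ∀ x y → family (proj₁ (unit-index x)) (fsuc y) ≡ unit x y
  family-unit x y = trans (cong (λ c → decode L c y) (proj₂ (unit-index x))) (decode-encode (unit x) y)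

  family-distinct : Distinct family
  family-distinct i j i≢j (inj₁ same) = i≢j (toℕ-injective (suc-injective (begin
    suc (toℕ i)  ≡⟨ toℕ-code i ⟨
    toℕ (code i) ≡⟨ cong toℕ (decode-injective L (same ∘ fsuc)) ⟩
    toℕ (code j) ≡⟨ toℕ-code j ⟩
    suc (toℕ j)  ∎)))
    where open ≡-Reasoning
  family-distinct i j i≢j (inj₂ complementary) with () ← complementary fzero

  decode-code≢false : ∀ i → ¬ (decode L (code i) ≗ λ _ → false)
  decode-code≢false i all-false = 0≢1+n (trans (sym (decode-false⇒toℕ≡0 L all-false)) (toℕ-code i))

  family-proper : AllProper family
  family-proper i
    with x , bit≢false ← ¬∀⟶∃¬ L _ (λ x → decode L (code i) x Bool.≟ false) (decode-code≢false i) =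
    fsuc x , fzero , Bool.¬-not bit≢false , refl

  family-separating : Separating family
  family-separating fzero    fzero    0≢0 = ⊥-elim (0≢0 refl)
  family-separating fzero    (fsuc y) _   = proj₁ (unit-index y) , λ false≡bit →
    Bool.not-¬ (unit-self y) (sym (trans false≡bit (family-unit y y)))
  family-separating (fsuc x) fzero    _   = proj₁ (unit-index x) , λ bit≡false →
    Bool.not-¬ (unit-self x) (trans (sym (family-unit x x)) bit≡false)
  family-separating (fsuc x) (fsuc y) x≢y = proj₁ (unit-index x) , λ same →
    Bool.not-¬ (unit-self x) (begin
      unit x x                               ≡⟨ family-unit x x ⟨
      family (proj₁ (unit-index x)) (fsuc x) ≡⟨ same ⟩
      family (proj₁ (unit-index x)) (fsuc y) ≡⟨ family-unit x y ⟩
      unit x y                               ≡⟨ unit-other x y (x≢y ∘ cong fsuc) ⟩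
      false                                  ∎)
    where open ≡-Reasoning

  separatingFamily : HasSeparatingFamily k (suc L)
  separatingFamily = family , family-distinct , family-proper , family-separating

proposition3p19 : (k : ℕ) → 1 ≤ k →
    HasSeparatingFamily k (⌈log₂ (k + 1) ⌉ + 1)
      × ((n : ℕ) → HasSeparatingFamily k n → ⌈log₂ (k + 1) ⌉ + 1 ≤ n)
proposition3p19 k 1≤k rewrite +-comm k 1 | +-comm ⌈log₂ suc k ⌉ 1 =
  separatingFamily (⌈log₂n⌉≤m⇒n≤2^m _ ≤-refl) m<⌈log₂n⌉⇒2^m<n , λ _ → lower-bound 1≤k
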